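{- Let $\mu\geq 1$ be an integer, and suppose that the integer $k\geq 1$ is not divisible by any odd prime $p<2^\mu$. Then the polynomial $z^k+1$ divides $f_{2^\mu,(k+1)2^\mu-1}(z)$ in $\mathbb{Z}[z]$, where $f_{m,n}(z)=\sum_{j=0}^{n}\binom{n}{j}z^{\binom{j}{m}}$.
   Context: Here $\binom{j}{m}=0$ for $0\le j<m$. -}

module Defs where

open import Data.Nat using (ℕ; zero; suc)
open import Data.Nat.Combinatorics using (_C_)
open import Data.Integer using (ℤ; +_; 0ℤ; 1ℤ) renaming (_+_ to _+ℤ_; _*_ to _*ℤ_)
open import Data.List using (List; []; _∷_; replicate; _++_; [_])
open import Data.Product using (∃)
open import Relation.Binary.PropositionalEquality using (_≡_)

-- Polynomials in ℤ[z] as coefficient lists: the i-th entry is the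
-- coefficient of z^i.  Trailing zeros are allowed; equality of
-- polynomials is coefficientwise equality (_≈P_).
Poly : Set
Poly = List ℤ

coeff : Poly → ℕ → ℤ
coeff []       _       = 0ℤ
coeff (a ∷ p)  zero    = a
coeff (a ∷ p)  (suc i) = coeff p i

_+P_ : Poly → Poly → Poly
[]      +P q       = q
(a ∷ p) +P []      = a ∷ p
(a ∷ p) +P (b ∷ q) = (a +ℤ b) ∷ (p +P q)

scale : ℤ → Poly → Poly
scale c []      = []
scale c (a ∷ p) = (c *ℤ a) ∷ scale c p

_*P_ : Poly → Poly → Poly
[]      *P q = []
(a ∷ p) *P q = scale a q +P (0ℤ ∷ (p *P q))

_≈P_ : Poly → Poly → Set
p ≈P q = ∀ i → coeff p i ≡ coeff q i

_∣P_ : Poly → Poly → Set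
d ∣P f = ∃ λ (q : Poly) → f ≈P (d *P q)

monomial : ℤ → ℕ → Poly
monomial c d = replicate d 0ℤ ++ [ c ]

zPow+1 : ℕ → Poly
zPow+1 k = monomial 1ℤ k +P monomial 1ℤ 0

sumP : ℕ → (ℕ → Poly) → Poly
sumP zero    g = g 0
sumP (suc n) g = sumP n g +P g (suc n)

f : ℕ → ℕ → Poly
f m n = sumP n (λ j → monomial (+ (n C j)) (j C m))

-- Since n = (k + 1) 2^μ - 1 is odd and C(n,j) = C(n,n-j), f splits into the pairs
-- C(n,j) (z^C(j,m) + z^C(n-j,m)), where m = 2^μ, and z^k + 1 divides z^x + z^y whenever x - y
-- is an odd multiple of k. So it suffices that C(a,m) - C(b,m) ≡ k (mod 2k) whenever
-- a + b + 1 = km + m. Moving a unit from a to b with Pascal's rule reduces this to the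
-- congruences C(km+s,r) ≡ C(s,r) for r < m and C(km+s,m) ≡ C(s,m) + k (mod 2k), that is, to
-- 2k ∣ C(km,t) for 0 < t < m and C(km,m) ≡ k (mod 2k). Both follow from the absorption
-- identity t C(km,t) = km C(km-1,t-1): the odd part of t < m is coprime to 2k, since k has
-- no odd prime factor below m.
module Submission where

open import Defs
open import Data.Nat using (ℕ; zero; suc; pred; _+_; _*_; _∸_; _^_; _<_; _≤_; z<s; NonZero; NonTrivial)
open import Data.Nat.Properties
open import Data.Nat.Combinatorics using (_C_; nC1≡n; nCk+nC[k+1]≡[n+1]C[k+1]; k>n⇒nCk≡0; nCk≡nC[n∸k])
open import Data.Nat.Coprimality using (Coprime; coprime-divisor)
open import Data.Nat.Divisibility
open import Data.Nat.Induction using (<-rec)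
open import Data.Nat.ListAction using (product)
open import Data.Nat.Primality using (Prime; euclidsLemma; irreducible[2]; ¬prime[1])
open import Data.Nat.Primality.Factorisation using (factorise)
import Data.Nat.Tactic.RingSolver as ℕ-Solver
open import Data.Integer using (ℤ; +_; -_; -[1+_]; 0ℤ; 1ℤ; -1ℤ)
  renaming (_+_ to _+ℤ_; _-_ to _-ℤ_; _*_ to _*ℤ_; _^_ to _^ℤ_)
import Data.Integer.Properties as ℤP
import Data.Integer.Divisibility.Signed as ℤ∣
open ℤ∣ using () renaming (_∣_ to _∣ℤ_)
open import Data.Integer.Tactic.RingSolver using (solve-∀)
open import Data.List using ([]; _∷_; replicate; _++_)
open import Data.List.Relation.Unary.All using (_∷_)
open import Data.Product using (∃₂; ∃-syntax; _×_; _,_; proj₁; proj₂)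
open import Data.Sum using (_⊎_; inj₁; inj₂)
open import Function using (_∘_)
open import Relation.Nullary using (¬_; yes; no; contradiction)
open import Relation.Binary.PropositionalEquality
open ≡-Reasoning

C-absorption : ∀ n t → suc t * (n C suc t) ≡ n * (pred n C t)
C-absorption zero    t = *-zeroʳ (suc t)
C-absorption (suc n) t = absorption n t
  where
  absorption : ∀ n t → suc t * (suc n C suc t) ≡ suc n * (n C t)
  absorption n       zero    = trans (*-identityˡ _) (trans (nC1≡n (suc n)) (sym (*-identityʳ (suc n))))
  absorption zero    (suc t) = *-zeroʳ (suc (suc t))
  absorption (suc n) (suc t) = begin
    suc (suc t) * (suc (suc n) C suc (suc t))  ≡⟨ cong (suc (suc t) *_) (sym (nCk+nC[k+1]≡[n+1]C[k+1] (suc n) (suc t))) ⟩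
    suc (suc t) * (A + B)                      ≡⟨ regroup t A B ⟩
    suc t * A + A + suc (suc t) * B            ≡⟨ cong₂ (λ x y → x + A + y) (absorption n t) (absorption n (suc t)) ⟩
    suc n * (n C t) + A + suc n * (n C suc t)  ≡⟨ collect (suc n) (n C t) (n C suc t) A ⟩
    suc n * ((n C t) + (n C suc t)) + A        ≡⟨ cong (λ x → suc n * x + A) (nCk+nC[k+1]≡[n+1]C[k+1] n t) ⟩
    suc n * A + A                              ≡⟨ +-comm (suc n * A) A ⟩
    suc (suc n) * A                            ∎
    where
    A = suc n C suc t
    B = suc n C suc (suc t)
    regroup : ∀ t A B → suc (suc t) * (A + B) ≡ suc t * A + A + suc (suc t) * B
    regroup = ℕ-Solver.solve-∀
    collect : ∀ n x y A → n * x + A + n * y ≡ n * (x + y) + A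
    collect = ℕ-Solver.solve-∀

C-sym : ∀ i j {n} → i + j ≡ n → n C i ≡ n C j
C-sym i j refl = trans (nCk≡nC[n∸k] (m≤m+n i j)) (cong ((i + j) C_) (m+n∸m≡n i j))

nCr-odd-below : ∀ {n m} → (∀ {t} → 0 < t → t < m → 2 ∣ suc n C t) → ∀ {r} → r < m → 2 ∣ suc (n C r)
nCr-odd-below         _    {zero}  _     = ∣-refl
nCr-odd-below {n} {m} even {suc r} r+1<m = ∣m+n∣m⇒∣n (subst (2 ∣_) sum≡ (∣m∣n⇒∣m+n ∣-refl (even z<s r+1<m)))
                                                 (nCr-odd-below even (<-trans (n<1+n r) r+1<m))
  where
  sum≡ : 2 + suc n C suc r ≡ suc (n C r) + suc (n C suc r)
  sum≡ = trans (cong (λ x → 2 + x) (sym (nCk+nC[k+1]≡[n+1]C[k+1] n r))) (cong suc (sym (+-suc (n C r) (n C suc r))))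

2k∣kmCm+k : ∀ {k m} → .{{NonZero k}} → .{{NonZero m}} →
            (∀ {t} → 0 < t → t < m → 2 * k ∣ (k * m) C t) → 2 * k ∣ (k * m) C m + k
2k∣kmCm+k {k@(suc _)} {m@(suc m′)} 2k∣C
  with divides q 1+x≡q*2 ← nCr-odd-below (λ 0<t t<m → ∣-trans (m∣m*n k) (2k∣C 0<t t<m)) (n<1+n m′) =
  divides q (begin
    (k * m) C m + k   ≡⟨ cong (_+ k) c≡k*x ⟩
    k * x + k         ≡⟨ +-comm (k * x) k ⟩
    k + k * x         ≡⟨ *-suc k x ⟨
    k * suc x         ≡⟨ cong (k *_) 1+x≡q*2 ⟩
    k * (q * 2)       ≡⟨ reorder k q ⟩
    q * (2 * k)       ∎)
  where
  x = pred (k * m) C m′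
  c≡k*x : (k * m) C m ≡ k * x
  c≡k*x = *-cancelˡ-≡ _ _ m (trans (C-absorption (k * m) m′) (trans (cong (_* x) (*-comm k m)) (*-assoc m k x)))
  reorder : ∀ k q → k * (q * 2) ≡ q * (2 * k)
  reorder = ℕ-Solver.solve-∀

odd-part : ∀ t → .{{NonZero t}} → ∃₂ λ a o → ¬ 2 ∣ o × t ≡ 2 ^ a * o
odd-part = <-rec _ split
  where
  split : ∀ t → (∀ {s} → s < t → .{{NonZero s}} → ∃₂ λ a o → ¬ 2 ∣ o × s ≡ 2 ^ a * o) →
          .{{NonZero t}} → ∃₂ λ a o → ¬ 2 ∣ o × t ≡ 2 ^ a * o
  split t rec with 2 ∣? t
  ... | no 2∤t = 0 , t , 2∤t , sym (+-identityʳ t)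
  ... | yes 2∣t@(divides q t≡q*2) with a , o , 2∤o , q≡ ← rec (quotient-< 2∣t) {{quotient≢0 2∣t}} =
    suc a , o , 2∤o , (begin
      t                ≡⟨ t≡q*2 ⟩
      q * 2            ≡⟨ cong (_* 2) q≡ ⟩
      2 ^ a * o * 2    ≡⟨ reorder (2 ^ a) o ⟩
      2 * 2 ^ a * o    ∎)
    where
    reorder : ∀ x o → x * o * 2 ≡ 2 * x * o
    reorder = ℕ-Solver.solve-∀

prime-divisor : ∀ d → .{{NonTrivial d}} → ∃[ p ] Prime p × p ∣ d
prime-divisor d@(suc (suc _)) with factorise d
... | record { factors = p ∷ ps ; isFactorisation = d≡ ; factorsPrime = p-prime ∷ _ } =
  p , p-prime , divides (product ps) (trans d≡ (*-comm p (product ps)))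

C-pascalℤ : ∀ n r → + (suc n C suc r) ≡ + (n C r) +ℤ + (n C suc r)
C-pascalℤ n r = trans (cong +_ (sym (nCk+nC[k+1]≡[n+1]C[k+1] n r))) (ℤP.pos-+ (n C r) (n C suc r))

C-pascal-diff : ∀ x y r → + (suc x C suc r) -ℤ + (suc y C suc r) ≡
                (+ (x C r) -ℤ + (y C r)) +ℤ (+ (x C suc r) -ℤ + (y C suc r))
C-pascal-diff x y r = trans (cong₂ _-ℤ_ (C-pascalℤ x r) (C-pascalℤ y r))
                            (regroup (+ (x C r)) (+ (x C suc r)) (+ (y C r)) (+ (y C suc r)))
  where
  regroup : ∀ a b c d → (a +ℤ b) -ℤ (c +ℤ d) ≡ (a -ℤ c) +ℤ (b -ℤ d)
  regroup = solve-∀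

-- By upper negation (-1)^r C(b,r) = C(r-b-1,r), so for a + b + 1 = n + r this is C(a,r) - C(a-n,r).
Δ : ℕ → ℕ → ℕ → ℤ
Δ r a b = + (a C r) -ℤ (-1ℤ ^ℤ r) *ℤ + (b C r)

Δ-pascal : ∀ r a b → Δ (suc r) (suc a) b ≡ Δ (suc r) a (suc b) +ℤ Δ r a b
Δ-pascal r a b = begin
  + (suc a C suc r) -ℤ (-1ℤ *ℤ σ) *ℤ + (b C suc r)
    ≡⟨ cong (λ x → x -ℤ (-1ℤ *ℤ σ) *ℤ + (b C suc r)) (C-pascalℤ a r) ⟩
  (+ (a C r) +ℤ + (a C suc r)) -ℤ (-1ℤ *ℤ σ) *ℤ + (b C suc r)
    ≡⟨ regroup (+ (a C r)) (+ (a C suc r)) (+ (b C r)) (+ (b C suc r)) σ ⟩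
  (+ (a C suc r) -ℤ (-1ℤ *ℤ σ) *ℤ (+ (b C r) +ℤ + (b C suc r))) +ℤ Δ r a b
    ≡⟨ cong (λ x → (+ (a C suc r) -ℤ (-1ℤ *ℤ σ) *ℤ x) +ℤ Δ r a b) (C-pascalℤ b r) ⟨
  Δ (suc r) a (suc b) +ℤ Δ r a b
    ∎
  where
  σ = -1ℤ ^ℤ r
  regroup : ∀ a₀ a₁ b₀ b₁ σ → (a₀ +ℤ a₁) -ℤ (-1ℤ *ℤ σ) *ℤ b₁ ≡
            (a₁ -ℤ (-1ℤ *ℤ σ) *ℤ (b₀ +ℤ b₁)) +ℤ (a₀ -ℤ σ *ℤ b₀)
  regroup = solve-∀

module _ (M : ℤ) (n : ℕ) where

  DividesBinomialsBelow : ℕ → Set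
  DividesBinomialsBelow m = ∀ {t} → 0 < t → t < m → M ∣ℤ + (n C t)

  C-shift-below : ∀ {m} → DividesBinomialsBelow m → ∀ s {r} → r < m → M ∣ℤ + ((s + n) C r) -ℤ + (s C r)
  C-shift-below low s       {zero}  _   = ℤ∣.divides 0ℤ refl
  C-shift-below low zero    {suc r} r<m = subst (M ∣ℤ_) (sym (ℤP.+-identityʳ _)) (low z<s r<m)
  C-shift-below low (suc s) {suc r} r<m = subst (M ∣ℤ_) (sym (C-pascal-diff (s + n) s r))
    (ℤ∣.∣m∣n⇒∣m+n (C-shift-below low s (<-trans (n<1+n r) r<m)) (C-shift-below low s r<m))

  C-shift-top : ∀ {m′ c} → DividesBinomialsBelow (suc m′) → M ∣ℤ + (n C suc m′) +ℤ c →
                ∀ s → M ∣ℤ (+ ((s + n) C suc m′) -ℤ + (s C suc m′)) +ℤ c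
  C-shift-top {m′} {c} low top zero = subst (λ x → M ∣ℤ x +ℤ c) (sym (ℤP.+-identityʳ (+ (n C suc m′)))) top
  C-shift-top {m′} {c} low top (suc s) = subst (M ∣ℤ_) (sym split)
    (ℤ∣.∣m∣n⇒∣m+n (C-shift-below low s (n<1+n m′)) (C-shift-top low top s))
    where
    x = + ((s + n) C m′) -ℤ + (s C m′)
    y = + ((s + n) C suc m′) -ℤ + (s C suc m′)
    split : (+ ((suc s + n) C suc m′) -ℤ + (suc s C suc m′)) +ℤ c ≡ x +ℤ (y +ℤ c)
    split = trans (cong (_+ℤ c) (C-pascal-diff (s + n) s m′)) (ℤP.+-assoc x y c)

  Δ-below : ∀ {m} → DividesBinomialsBelow m → ∀ {r} a b → r < m → suc (a + b) ≡ r + n → M ∣ℤ Δ r a b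
  Δ-below low {zero}   a       b _   _ = ℤ∣.divides 0ℤ refl
  Δ-below low {suc r}  zero    b r<m e = subst (λ b → M ∣ℤ Δ (suc r) 0 b) (sym (suc-injective e))
    (subst (M ∣ℤ_) (negate-scaled (-1ℤ ^ℤ suc r) c) (ℤ∣.∣n⇒∣m*n (- (-1ℤ ^ℤ suc r))
      (subst (λ x → M ∣ℤ c -ℤ + x) (k>n⇒nCk≡0 (n<1+n r)) (C-shift-below low r r<m))))
    where
    c = + ((r + n) C suc r)
    negate-scaled : ∀ σ x → (- σ) *ℤ (x -ℤ 0ℤ) ≡ 0ℤ -ℤ σ *ℤ x
    negate-scaled = solve-∀
  Δ-below low {suc r}  (suc a) b r<m e = subst (M ∣ℤ_) (sym (Δ-pascal r a b))
    (ℤ∣.∣m∣n⇒∣m+n (Δ-below low a (suc b) r<m (trans (cong suc (+-suc a b)) e))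
                  (Δ-below low a b (<-trans (n<1+n r) r<m) (suc-injective e)))

  Δ-top : ∀ {m′ c} → DividesBinomialsBelow (suc m′) → M ∣ℤ + (n C suc m′) +ℤ c →
          ∀ a b → suc (a + b) ≡ suc m′ + n → M ∣ℤ Δ (suc m′) a b -ℤ (-1ℤ ^ℤ suc m′) *ℤ c
  Δ-top {m′} {c} low top zero    b e = subst (λ b → M ∣ℤ Δ (suc m′) 0 b -ℤ σ *ℤ c) (sym (suc-injective e))
    (subst (M ∣ℤ_) (negate-scaled σ x c) (ℤ∣.∣n⇒∣m*n (- σ)
      (subst (λ y → M ∣ℤ (x -ℤ + y) +ℤ c) (k>n⇒nCk≡0 (n<1+n m′)) (C-shift-top low top m′))))
    where
    σ = -1ℤ ^ℤ suc m′
    x = + ((m′ + n) C suc m′)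
    negate-scaled : ∀ σ x c → (- σ) *ℤ ((x -ℤ 0ℤ) +ℤ c) ≡ (0ℤ -ℤ σ *ℤ x) -ℤ σ *ℤ c
    negate-scaled = solve-∀
  Δ-top {m′} {c} low top (suc a) b e = subst (M ∣ℤ_) split
    (ℤ∣.∣m∣n⇒∣m+n (Δ-top low top a (suc b) (trans (cong suc (+-suc a b)) e))
                  (Δ-below low a b (n<1+n m′) (suc-injective e)))
    where
    σc = (-1ℤ ^ℤ suc m′) *ℤ c
    split : (Δ (suc m′) a (suc b) -ℤ σc) +ℤ Δ m′ a b ≡ Δ (suc m′) (suc a) b -ℤ σc
    split = trans (regroup (Δ (suc m′) a (suc b)) (Δ m′ a b) σc) (cong (_-ℤ σc) (sym (Δ-pascal m′ a b)))
      where
      regroup : ∀ x y z → (x -ℤ z) +ℤ y ≡ (x +ℤ y) -ℤ z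
      regroup = solve-∀

-1^2^μ≡1 : ∀ {μ} → 1 ≤ μ → -1ℤ ^ℤ (2 ^ μ) ≡ 1ℤ
-1^2^μ≡1 {suc μ} _ = trans (sym (ℤP.^-*-assoc -1ℤ 2 (2 ^ μ))) (ℤP.^-zeroˡ (2 ^ μ))

pos-odd-offset : ∀ w k x → + (w * (2 * k) + (k + x)) ≡ + w *ℤ + (2 * k) +ℤ (+ k +ℤ + x)
pos-odd-offset w k x = trans (ℤP.pos-+ (w * (2 * k)) (k + x)) (cong₂ _+ℤ_ (ℤP.pos-* w (2 * k)) (ℤP.pos-+ k x))

odd-multiple-apart : ∀ k x y → + (2 * k) ∣ℤ (+ x -ℤ + y) -ℤ + k →
                     ∃[ w ] (y ≡ w * (2 * k) + (k + x) ⊎ x ≡ w * (2 * k) + (k + y))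
odd-multiple-apart k x y (ℤ∣.divides (+ w) e) = w , inj₂ (ℤP.+-injective (begin
  + x                                        ≡⟨ recover-x (+ x) (+ y) (+ k) ⟩
  ((+ x -ℤ + y) -ℤ + k) +ℤ (+ k +ℤ + y)      ≡⟨ cong (_+ℤ (+ k +ℤ + y)) e ⟩
  + w *ℤ + (2 * k) +ℤ (+ k +ℤ + y)           ≡⟨ pos-odd-offset w k y ⟨
  + (w * (2 * k) + (k + y))                  ∎))
  where
  recover-x : ∀ x y k → x ≡ ((x -ℤ y) -ℤ k) +ℤ (k +ℤ y)
  recover-x = solve-∀
odd-multiple-apart k x y (ℤ∣.divides -[1+ w ] e) = w , inj₁ (ℤP.+-injective (begin
  + y                                                      ≡⟨ recover-y (+ x) (+ y) (+ k) ⟩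
  (+ x +ℤ + k) -ℤ ((+ x -ℤ + y) -ℤ + k) -ℤ + 2 *ℤ + k
    ≡⟨ cong (λ z → (+ x +ℤ + k) -ℤ z -ℤ + 2 *ℤ + k) (trans e (cong (-[1+ w ] *ℤ_) (ℤP.pos-* 2 k))) ⟩
  (+ x +ℤ + k) -ℤ -[1+ w ] *ℤ (+ 2 *ℤ + k) -ℤ + 2 *ℤ + k ≡⟨ regroup (+ x) (+ k) (+ w) ⟩
  + w *ℤ (+ 2 *ℤ + k) +ℤ (+ k +ℤ + x)                      ≡⟨ cong (λ z → + w *ℤ z +ℤ (+ k +ℤ + x)) (ℤP.pos-* 2 k) ⟨
  + w *ℤ + (2 * k) +ℤ (+ k +ℤ + x)                         ≡⟨ pos-odd-offset w k x ⟨
  + (w * (2 * k) + (k + x))                                ∎))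
  where
  recover-y : ∀ x y k → y ≡ (x +ℤ k) -ℤ ((x -ℤ y) -ℤ k) -ℤ + 2 *ℤ k
  recover-y = solve-∀
  -- applied with -[1+ w ], which is definitionally - (1ℤ +ℤ + w)
  regroup : ∀ x k w → (x +ℤ k) -ℤ (- (1ℤ +ℤ w)) *ℤ (+ 2 *ℤ k) -ℤ + 2 *ℤ k ≡ w *ℤ (+ 2 *ℤ k) +ℤ (k +ℤ x)
  regroup = solve-∀

module _ {k μ : ℕ} (k-rough : ∀ p → Prime p → ¬ 2 ∣ p → p < 2 ^ μ → ¬ p ∣ k) where

  coprime-2k-odd : ∀ {o} → ¬ 2 ∣ o → o < 2 ^ μ → Coprime (2 * k) o
  coprime-2k-odd {zero}    2∤o _   _                = contradiction (2 ∣0) 2∤o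
  coprime-2k-odd {suc o}   _   _   {zero}  (_ , 0∣o) = contradiction (0∣⇒≡0 0∣o) λ ()
  coprime-2k-odd {suc o}   _   _   {1}     _         = refl
  coprime-2k-odd {o@(suc _)} 2∤o o<m {d@(suc (suc _))} (d∣2k , d∣o)
    with p , p-prime , p∣d ← prime-divisor d
    with euclidsLemma 2 k p-prime (∣-trans p∣d d∣2k)
  ... | inj₂ p∣k = contradiction p∣k (k-rough p p-prime 2∤p (≤-<-trans (∣⇒≤ p∣o) o<m))
    where
    p∣o = ∣-trans p∣d d∣o
    2∤p : ¬ 2 ∣ p
    2∤p 2∣p = 2∤o (∣-trans 2∣p p∣o)
  ... | inj₁ p∣2 with irreducible[2] p∣2
  ...   | inj₁ refl = contradiction p-prime ¬prime[1]
  ...   | inj₂ refl = contradiction (∣-trans p∣d d∣o) 2∤o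

  2k∣kmCt : ∀ {t} → 0 < t → t < 2 ^ μ → 2 * k ∣ (k * 2 ^ μ) C t
  2k∣kmCt {t@(suc t′)} _ t<m with a , o , 2∤o , t≡ ← odd-part t with a <? μ
  ... | no a≮μ = contradiction t<m (≤⇒≯ (≤-trans (^-monoʳ-≤ 2 (≮⇒≥ a≮μ)) 2^a≤t))
    where
    2^a≤t : 2 ^ a ≤ t
    2^a≤t = ∣⇒≤ (subst (2 ^ a ∣_) (sym t≡) (m∣m*n o))
  ... | yes a<μ =
    coprime-divisor (coprime-2k-odd 2∤o o<m) (divides (2 ^ b * x) (*-cancelˡ-≡ _ _ (2 ^ a) (begin
      2 ^ a * (o * c)                 ≡⟨ *-assoc (2 ^ a) o c ⟨
      2 ^ a * o * c                   ≡⟨ cong (_* c) t≡ ⟨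
      t * c                           ≡⟨ C-absorption km t′ ⟩
      km * x                          ≡⟨ cong (λ e → k * 2 ^ e * x) μ≡ ⟨
      k * 2 ^ (a + suc b) * x         ≡⟨ cong (λ e → k * e * x) (^-distribˡ-+-* 2 a (suc b)) ⟩
      k * (2 ^ a * (2 * 2 ^ b)) * x   ≡⟨ reorder k (2 ^ a) (2 ^ b) x ⟩
      2 ^ a * (2 ^ b * x * (2 * k))   ∎)))
    where
    instance _ = m^n≢0 2 a
    km = k * 2 ^ μ
    c = km C t
    x = pred km C t′
    b = proj₁ (m≤n⇒∃[o]m+o≡n a<μ)
    μ≡ : a + suc b ≡ μ
    μ≡ = trans (+-suc a b) (proj₂ (m≤n⇒∃[o]m+o≡n a<μ))
    o<m : o < 2 ^ μ
    o<m = ≤-<-trans (≤-trans (m≤n*m o (2 ^ a)) (≤-reflexive (sym t≡))) t<m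
    reorder : ∀ k x y X → k * (x * (2 * y)) * X ≡ x * (y * X * (2 * k))
    reorder = ℕ-Solver.solve-∀

  mirror-gap : .{{NonZero k}} → 1 ≤ μ → ∀ a b → suc (a + b) ≡ 2 ^ μ + k * 2 ^ μ →
               + (2 * k) ∣ℤ (+ (a C 2 ^ μ) -ℤ + (b C 2 ^ μ)) -ℤ + k
  mirror-gap 1≤μ a b e = subst (λ m → M ∣ℤ (+ (a C m) -ℤ + (b C m)) -ℤ + k) m≡
    (subst (M ∣ℤ_) unit-sign (Δ-top M n low top a b (trans e (cong (_+ n) (sym m≡)))))
    where
    instance _ = m^n≢0 2 μ
    M = + (2 * k)
    n = k * 2 ^ μ
    m′ = pred (2 ^ μ)
    m≡ : suc m′ ≡ 2 ^ μ
    m≡ = suc-pred (2 ^ μ)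
    low : DividesBinomialsBelow M n (suc m′)
    low {t} 0<t t<m = ℤ∣.∣ᵤ⇒∣ (2k∣kmCt 0<t (subst (t <_) m≡ t<m))
    top : M ∣ℤ + (n C suc m′) +ℤ + k
    top = subst (λ m → M ∣ℤ + (n C m) +ℤ + k) (sym m≡)
                (subst (M ∣ℤ_) (ℤP.pos-+ (n C 2 ^ μ) k) (ℤ∣.∣ᵤ⇒∣ (2k∣kmCm+k 2k∣kmCt)))
    unit-sign : Δ (suc m′) a b -ℤ (-1ℤ ^ℤ suc m′) *ℤ + k ≡ (+ (a C suc m′) -ℤ + (b C suc m′)) -ℤ + k
    unit-sign = trans (cong (λ σ → (+ (a C suc m′) -ℤ σ *ℤ + (b C suc m′)) -ℤ σ *ℤ + k)
                            (trans (cong (-1ℤ ^ℤ_) m≡) (-1^2^μ≡1 1≤μ)))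
                      (drop-unit (+ (a C suc m′)) (+ (b C suc m′)) (+ k))
      where
      drop-unit : ∀ x y k → (x -ℤ 1ℤ *ℤ y) -ℤ 1ℤ *ℤ k ≡ (x -ℤ y) -ℤ k
      drop-unit = solve-∀

coeff-+P : ∀ p q i → coeff (p +P q) i ≡ coeff p i +ℤ coeff q i
coeff-+P []      q       i       = sym (ℤP.+-identityˡ _)
coeff-+P (a ∷ p) []      i       = sym (ℤP.+-identityʳ _)
coeff-+P (a ∷ p) (b ∷ q) zero    = refl
coeff-+P (a ∷ p) (b ∷ q) (suc i) = coeff-+P p q i

coeff-scale : ∀ c p i → coeff (scale c p) i ≡ c *ℤ coeff p i
coeff-scale c []      i       = sym (ℤP.*-zeroʳ c)
coeff-scale c (a ∷ p) zero    = refl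
coeff-scale c (a ∷ p) (suc i) = coeff-scale c p i

coeff-∷*P-zero : ∀ a p q → coeff ((a ∷ p) *P q) 0 ≡ a *ℤ coeff q 0
coeff-∷*P-zero a p q = trans (coeff-+P (scale a q) (0ℤ ∷ (p *P q)) 0) (trans (ℤP.+-identityʳ _) (coeff-scale a q 0))

coeff-∷*P-suc : ∀ a p q i → coeff ((a ∷ p) *P q) (suc i) ≡ a *ℤ coeff q (suc i) +ℤ coeff (p *P q) i
coeff-∷*P-suc a p q i = trans (coeff-+P (scale a q) (0ℤ ∷ (p *P q)) (suc i)) (cong (_+ℤ _) (coeff-scale a q (suc i)))

*P-distribˡ-+P : ∀ d p q → (d *P (p +P q)) ≈P ((d *P p) +P (d *P q))
*P-distribˡ-+P []      p q i       = refl
*P-distribˡ-+P (a ∷ d) p q zero    = begin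
  coeff ((a ∷ d) *P (p +P q)) 0                       ≡⟨ coeff-∷*P-zero a d (p +P q) ⟩
  a *ℤ coeff (p +P q) 0                               ≡⟨ cong (a *ℤ_) (coeff-+P p q 0) ⟩
  a *ℤ (coeff p 0 +ℤ coeff q 0)                       ≡⟨ ℤP.*-distribˡ-+ a (coeff p 0) (coeff q 0) ⟩
  a *ℤ coeff p 0 +ℤ a *ℤ coeff q 0                    ≡⟨ cong₂ _+ℤ_ (coeff-∷*P-zero a d p) (coeff-∷*P-zero a d q) ⟨
  coeff ((a ∷ d) *P p) 0 +ℤ coeff ((a ∷ d) *P q) 0    ≡⟨ coeff-+P ((a ∷ d) *P p) ((a ∷ d) *P q) 0 ⟨
  coeff (((a ∷ d) *P p) +P ((a ∷ d) *P q)) 0          ∎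
*P-distribˡ-+P (a ∷ d) p q (suc i) = begin
  coeff ((a ∷ d) *P (p +P q)) (suc i)                 ≡⟨ coeff-∷*P-suc a d (p +P q) i ⟩
  a *ℤ coeff (p +P q) (suc i) +ℤ coeff (d *P (p +P q)) i
    ≡⟨ cong₂ (λ x y → a *ℤ x +ℤ y) (coeff-+P p q (suc i)) (trans (*P-distribˡ-+P d p q i) (coeff-+P (d *P p) (d *P q) i)) ⟩
  a *ℤ (pᵢ +ℤ qᵢ) +ℤ (coeff (d *P p) i +ℤ coeff (d *P q) i)
    ≡⟨ regroup a pᵢ qᵢ (coeff (d *P p) i) (coeff (d *P q) i) ⟩
  (a *ℤ pᵢ +ℤ coeff (d *P p) i) +ℤ (a *ℤ qᵢ +ℤ coeff (d *P q) i)
    ≡⟨ cong₂ _+ℤ_ (coeff-∷*P-suc a d p i) (coeff-∷*P-suc a d q i) ⟨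
  coeff ((a ∷ d) *P p) (suc i) +ℤ coeff ((a ∷ d) *P q) (suc i)
    ≡⟨ coeff-+P ((a ∷ d) *P p) ((a ∷ d) *P q) (suc i) ⟨
  coeff (((a ∷ d) *P p) +P ((a ∷ d) *P q)) (suc i)    ∎
  where
  pᵢ = coeff p (suc i)
  qᵢ = coeff q (suc i)
  regroup : ∀ a p q x y → a *ℤ (p +ℤ q) +ℤ (x +ℤ y) ≡ (a *ℤ p +ℤ x) +ℤ (a *ℤ q +ℤ y)
  regroup = solve-∀

*P-scaleʳ : ∀ c d q → (d *P scale c q) ≈P scale c (d *P q)
*P-scaleʳ c []      q i       = refl
*P-scaleʳ c (a ∷ d) q zero    = begin
  coeff ((a ∷ d) *P scale c q) 0      ≡⟨ coeff-∷*P-zero a d (scale c q) ⟩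
  a *ℤ coeff (scale c q) 0            ≡⟨ cong (a *ℤ_) (coeff-scale c q 0) ⟩
  a *ℤ (c *ℤ coeff q 0)               ≡⟨ swap a c (coeff q 0) ⟩
  c *ℤ (a *ℤ coeff q 0)               ≡⟨ cong (c *ℤ_) (coeff-∷*P-zero a d q) ⟨
  c *ℤ coeff ((a ∷ d) *P q) 0         ≡⟨ coeff-scale c ((a ∷ d) *P q) 0 ⟨
  coeff (scale c ((a ∷ d) *P q)) 0    ∎
  where
  swap : ∀ a c x → a *ℤ (c *ℤ x) ≡ c *ℤ (a *ℤ x)
  swap = solve-∀
*P-scaleʳ c (a ∷ d) q (suc i) = begin
  coeff ((a ∷ d) *P scale c q) (suc i)                       ≡⟨ coeff-∷*P-suc a d (scale c q) i ⟩
  a *ℤ coeff (scale c q) (suc i) +ℤ coeff (d *P scale c q) i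
    ≡⟨ cong₂ (λ x y → a *ℤ x +ℤ y) (coeff-scale c q (suc i)) (trans (*P-scaleʳ c d q i) (coeff-scale c (d *P q) i)) ⟩
  a *ℤ (c *ℤ qᵢ) +ℤ c *ℤ coeff (d *P q) i                    ≡⟨ regroup a c qᵢ (coeff (d *P q) i) ⟩
  c *ℤ (a *ℤ qᵢ +ℤ coeff (d *P q) i)                         ≡⟨ cong (c *ℤ_) (coeff-∷*P-suc a d q i) ⟨
  c *ℤ coeff ((a ∷ d) *P q) (suc i)                          ≡⟨ coeff-scale c ((a ∷ d) *P q) (suc i) ⟨
  coeff (scale c ((a ∷ d) *P q)) (suc i)                     ∎
  where
  qᵢ = coeff q (suc i)
  regroup : ∀ a c q x → a *ℤ (c *ℤ q) +ℤ c *ℤ x ≡ c *ℤ (a *ℤ q +ℤ x)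
  regroup = solve-∀

+P-identityʳ : ∀ p → p +P [] ≡ p
+P-identityʳ []      = refl
+P-identityʳ (a ∷ p) = refl

*P-distribʳ-+P : ∀ p q r → ((p +P q) *P r) ≈P ((p *P r) +P (q *P r))
*P-distribʳ-+P []      q       r i       = refl
*P-distribʳ-+P (a ∷ p) []      r i       = sym (cong (λ x → coeff x i) (+P-identityʳ ((a ∷ p) *P r)))
*P-distribʳ-+P (a ∷ p) (b ∷ q) r zero    = begin
  coeff (((a +ℤ b) ∷ (p +P q)) *P r) 0                ≡⟨ coeff-∷*P-zero (a +ℤ b) (p +P q) r ⟩
  (a +ℤ b) *ℤ coeff r 0                               ≡⟨ ℤP.*-distribʳ-+ (coeff r 0) a b ⟩
  a *ℤ coeff r 0 +ℤ b *ℤ coeff r 0                    ≡⟨ cong₂ _+ℤ_ (coeff-∷*P-zero a p r) (coeff-∷*P-zero b q r) ⟨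
  coeff ((a ∷ p) *P r) 0 +ℤ coeff ((b ∷ q) *P r) 0    ≡⟨ coeff-+P ((a ∷ p) *P r) ((b ∷ q) *P r) 0 ⟨
  coeff (((a ∷ p) *P r) +P ((b ∷ q) *P r)) 0          ∎
*P-distribʳ-+P (a ∷ p) (b ∷ q) r (suc i) = begin
  coeff (((a +ℤ b) ∷ (p +P q)) *P r) (suc i)          ≡⟨ coeff-∷*P-suc (a +ℤ b) (p +P q) r i ⟩
  (a +ℤ b) *ℤ rᵢ +ℤ coeff ((p +P q) *P r) i
    ≡⟨ cong ((a +ℤ b) *ℤ rᵢ +ℤ_) (trans (*P-distribʳ-+P p q r i) (coeff-+P (p *P r) (q *P r) i)) ⟩
  (a +ℤ b) *ℤ rᵢ +ℤ (coeff (p *P r) i +ℤ coeff (q *P r) i)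
    ≡⟨ regroup a b rᵢ (coeff (p *P r) i) (coeff (q *P r) i) ⟩
  (a *ℤ rᵢ +ℤ coeff (p *P r) i) +ℤ (b *ℤ rᵢ +ℤ coeff (q *P r) i)
    ≡⟨ cong₂ _+ℤ_ (coeff-∷*P-suc a p r i) (coeff-∷*P-suc b q r i) ⟨
  coeff ((a ∷ p) *P r) (suc i) +ℤ coeff ((b ∷ q) *P r) (suc i)
    ≡⟨ coeff-+P ((a ∷ p) *P r) ((b ∷ q) *P r) (suc i) ⟨
  coeff (((a ∷ p) *P r) +P ((b ∷ q) *P r)) (suc i)    ∎
  where
  rᵢ = coeff r (suc i)
  regroup : ∀ a b r x y → (a +ℤ b) *ℤ r +ℤ (x +ℤ y) ≡ (a *ℤ r +ℤ x) +ℤ (b *ℤ r +ℤ y)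
  regroup = solve-∀

monomial-1-*P : ∀ d q → (monomial 1ℤ d *P q) ≈P (replicate d 0ℤ ++ q)
monomial-1-*P zero    q zero    = trans (coeff-∷*P-zero 1ℤ [] q) (ℤP.*-identityˡ _)
monomial-1-*P zero    q (suc i) = trans (coeff-∷*P-suc 1ℤ [] q i) (trans (ℤP.+-identityʳ _) (ℤP.*-identityˡ _))
monomial-1-*P (suc d) q zero    = coeff-∷*P-zero 0ℤ (monomial 1ℤ d) q
monomial-1-*P (suc d) q (suc i) =
  trans (coeff-∷*P-suc 0ℤ (monomial 1ℤ d) q i) (trans (ℤP.+-identityˡ _) (monomial-1-*P d q i))

replicate-++-monomial : ∀ d c x → replicate d 0ℤ ++ monomial c x ≡ monomial c (d + x)
replicate-++-monomial zero    c x = refl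
replicate-++-monomial (suc d) c x = cong (0ℤ ∷_) (replicate-++-monomial d c x)

+P-comm : ∀ p q → (p +P q) ≈P (q +P p)
+P-comm p q i = trans (coeff-+P p q i) (trans (ℤP.+-comm (coeff p i) (coeff q i)) (sym (coeff-+P q p i)))

∣P-resp-≈P : ∀ d p q → p ≈P q → d ∣P p → d ∣P q
∣P-resp-≈P d p q p≈q (r , p≈dr) = r , λ i → trans (sym (p≈q i)) (p≈dr i)

∣P-+P : ∀ d p q → d ∣P p → d ∣P q → d ∣P (p +P q)
∣P-+P d p q (r , p≈dr) (s , q≈ds) = r +P s , λ i → begin
  coeff (p +P q) i                       ≡⟨ coeff-+P p q i ⟩
  coeff p i +ℤ coeff q i                 ≡⟨ cong₂ _+ℤ_ (p≈dr i) (q≈ds i) ⟩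
  coeff (d *P r) i +ℤ coeff (d *P s) i   ≡⟨ coeff-+P (d *P r) (d *P s) i ⟨
  coeff ((d *P r) +P (d *P s)) i         ≡⟨ *P-distribˡ-+P d r s i ⟨
  coeff (d *P (r +P s)) i                ∎

∣P-scale : ∀ d c p → d ∣P p → d ∣P scale c p
∣P-scale d c p (r , p≈dr) = scale c r , λ i → begin
  coeff (scale c p) i          ≡⟨ coeff-scale c p i ⟩
  c *ℤ coeff p i               ≡⟨ cong (c *ℤ_) (p≈dr i) ⟩
  c *ℤ coeff (d *P r) i        ≡⟨ coeff-scale c (d *P r) i ⟨
  coeff (scale c (d *P r)) i   ≡⟨ *P-scaleʳ c d r i ⟨
  coeff (d *P scale c r) i     ∎

zPow+1-∣P-shift : ∀ k c x → zPow+1 k ∣P (monomial c x +P monomial c (k + x))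
zPow+1-∣P-shift k c x = monomial c x , λ i → begin
  coeff (monomial c x +P monomial c (k + x)) i                         ≡⟨ +P-comm (monomial c x) (monomial c (k + x)) i ⟩
  coeff (monomial c (k + x) +P monomial c x) i                         ≡⟨ coeff-+P (monomial c (k + x)) (monomial c x) i ⟩
  coeff (monomial c (k + x)) i +ℤ coeff (monomial c x) i
    ≡⟨ cong₂ _+ℤ_ (trans (monomial-1-*P k (monomial c x) i) (cong (λ p → coeff p i) (replicate-++-monomial k c x)))
                  (monomial-1-*P 0 (monomial c x) i) ⟨
  coeff (monomial 1ℤ k *P monomial c x) i +ℤ coeff (monomial 1ℤ 0 *P monomial c x) i
    ≡⟨ coeff-+P (monomial 1ℤ k *P monomial c x) (monomial 1ℤ 0 *P monomial c x) i ⟨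
  coeff ((monomial 1ℤ k *P monomial c x) +P (monomial 1ℤ 0 *P monomial c x)) i
    ≡⟨ *P-distribʳ-+P (monomial 1ℤ k) (monomial 1ℤ 0) (monomial c x) i ⟨
  coeff (zPow+1 k *P monomial c x) i                                    ∎

+P-telescope : ∀ p q r s → (((p +P q) +P scale -1ℤ (q +P r)) +P (r +P s)) ≈P (p +P s)
+P-telescope p q r s i = begin
  coeff (((p +P q) +P scale -1ℤ (q +P r)) +P (r +P s)) i
    ≡⟨ coeff-+P ((p +P q) +P scale -1ℤ (q +P r)) (r +P s) i ⟩
  coeff ((p +P q) +P scale -1ℤ (q +P r)) i +ℤ coeff (r +P s) i
    ≡⟨ cong (_+ℤ coeff (r +P s) i) (coeff-+P (p +P q) (scale -1ℤ (q +P r)) i) ⟩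
  (coeff (p +P q) i +ℤ coeff (scale -1ℤ (q +P r)) i) +ℤ coeff (r +P s) i
    ≡⟨ cong₂ (λ x y → (x +ℤ y) +ℤ coeff (r +P s) i)
             (coeff-+P p q i) (trans (coeff-scale -1ℤ (q +P r) i) (cong (-1ℤ *ℤ_) (coeff-+P q r i))) ⟩
  ((pᵢ +ℤ qᵢ) +ℤ -1ℤ *ℤ (qᵢ +ℤ rᵢ)) +ℤ coeff (r +P s) i
    ≡⟨ cong (((pᵢ +ℤ qᵢ) +ℤ -1ℤ *ℤ (qᵢ +ℤ rᵢ)) +ℤ_) (coeff-+P r s i) ⟩
  ((pᵢ +ℤ qᵢ) +ℤ -1ℤ *ℤ (qᵢ +ℤ rᵢ)) +ℤ (rᵢ +ℤ sᵢ)
    ≡⟨ cancel pᵢ qᵢ rᵢ sᵢ ⟩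
  pᵢ +ℤ sᵢ
    ≡⟨ coeff-+P p s i ⟨
  coeff (p +P s) i ∎
  where
  pᵢ = coeff p i
  qᵢ = coeff q i
  rᵢ = coeff r i
  sᵢ = coeff s i
  cancel : ∀ p q r s → ((p +ℤ q) +ℤ -1ℤ *ℤ (q +ℤ r)) +ℤ (r +ℤ s) ≡ p +ℤ s
  cancel = solve-∀

zPow+1-∣P-odd-gap : ∀ k c x w → zPow+1 k ∣P (monomial c x +P monomial c (w * (2 * k) + (k + x)))
zPow+1-∣P-odd-gap k c x zero    = zPow+1-∣P-shift k c x
zPow+1-∣P-odd-gap k c x (suc w) = subst (λ e → zPow+1 k ∣P (mx +P monomial c e)) (sym (two-more-steps w k x))
  (∣P-resp-≈P d telescope (mx +P mkkb) (+P-telescope mx mb mkb mkkb) telescoped)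
  where
  d = zPow+1 k
  b = w * (2 * k) + (k + x)
  mx = monomial c x
  mb = monomial c b
  mkb = monomial c (k + b)
  mkkb = monomial c (k + (k + b))
  telescope = ((mx +P mb) +P scale -1ℤ (mb +P mkb)) +P (mkb +P mkkb)
  telescoped : d ∣P telescope
  telescoped = ∣P-+P d ((mx +P mb) +P scale -1ℤ (mb +P mkb)) (mkb +P mkkb)
    (∣P-+P d (mx +P mb) (scale -1ℤ (mb +P mkb))
      (zPow+1-∣P-odd-gap k c x w) (∣P-scale d -1ℤ (mb +P mkb) (zPow+1-∣P-shift k c b)))
    (zPow+1-∣P-shift k c (k + b))
  two-more-steps : ∀ w k x → suc w * (2 * k) + (k + x) ≡ k + (k + (w * (2 * k) + (k + x)))
  two-more-steps = ℕ-Solver.solve-∀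

zPow+1-∣P-monomial-pair : ∀ k c x y → + (2 * k) ∣ℤ (+ x -ℤ + y) -ℤ + k →
                          zPow+1 k ∣P (monomial c x +P monomial c y)
zPow+1-∣P-monomial-pair k c x y gap with odd-multiple-apart k x y gap
... | w , inj₁ refl = zPow+1-∣P-odd-gap k c x w
... | w , inj₂ refl = ∣P-resp-≈P (zPow+1 k) (monomial c y +P monomial c x) (monomial c x +P monomial c y)
                        (+P-comm (monomial c y) (monomial c x)) (zPow+1-∣P-odd-gap k c y w)

sumP-unfoldˡ : ∀ n g → sumP (suc n) g ≈P (g 0 +P sumP n (g ∘ suc))
sumP-unfoldˡ zero    g i = refl
sumP-unfoldˡ (suc n) g i = begin
  coeff (sumP (suc n) g +P g (suc (suc n))) i                           ≡⟨ coeff-+P (sumP (suc n) g) (g (suc (suc n))) i ⟩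
  coeff (sumP (suc n) g) i +ℤ coeff (g (suc (suc n))) i
    ≡⟨ cong (_+ℤ coeff (g (suc (suc n))) i) (trans (sumP-unfoldˡ n g i) (coeff-+P (g 0) (sumP n (g ∘ suc)) i)) ⟩
  (coeff (g 0) i +ℤ coeff (sumP n (g ∘ suc)) i) +ℤ coeff (g (suc (suc n))) i
    ≡⟨ ℤP.+-assoc (coeff (g 0) i) (coeff (sumP n (g ∘ suc)) i) (coeff (g (suc (suc n))) i) ⟩
  coeff (g 0) i +ℤ (coeff (sumP n (g ∘ suc)) i +ℤ coeff (g (suc (suc n))) i)
    ≡⟨ cong (coeff (g 0) i +ℤ_) (coeff-+P (sumP n (g ∘ suc)) (g (suc (suc n))) i) ⟨
  coeff (g 0) i +ℤ coeff (sumP (suc n) (g ∘ suc)) i                     ≡⟨ coeff-+P (g 0) (sumP (suc n) (g ∘ suc)) i ⟨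
  coeff (g 0 +P sumP (suc n) (g ∘ suc)) i                               ∎

∣P-sumP-pairs : ∀ d N g → (∀ i j → i + j ≡ suc (N + N) → d ∣P (g i +P g j)) → d ∣P sumP (suc (N + N)) g
∣P-sumP-pairs d zero    g pairs = pairs 0 1 refl
∣P-sumP-pairs d (suc N) g pairs = subst (λ n → d ∣P sumP n g) (sym n≡)
  (∣P-resp-≈P d ((g 0 +P g (suc n)) +P inner) (sumP (suc n) g) regroup
    (∣P-+P d (g 0 +P g (suc n)) inner (pairs 0 (suc n) (sym n≡)) (∣P-sumP-pairs d N (g ∘ suc) inner-pairs)))
  where
  n = suc (suc (N + N))
  n≡ : suc (suc N + suc N) ≡ suc n
  n≡ = cong (suc ∘ suc) (+-suc N N)
  inner = sumP (suc (N + N)) (g ∘ suc)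
  inner-pairs : ∀ i j → i + j ≡ suc (N + N) → d ∣P (g (suc i) +P g (suc j))
  inner-pairs i j e = pairs (suc i) (suc j) (trans (cong suc (trans (+-suc i j) (cong suc e))) (sym n≡))
  regroup : ((g 0 +P g (suc n)) +P inner) ≈P sumP (suc n) g
  regroup i = begin
    coeff ((g 0 +P g (suc n)) +P inner) i                    ≡⟨ coeff-+P (g 0 +P g (suc n)) inner i ⟩
    coeff (g 0 +P g (suc n)) i +ℤ coeff inner i              ≡⟨ cong (_+ℤ coeff inner i) (coeff-+P (g 0) (g (suc n)) i) ⟩
    (coeff (g 0) i +ℤ coeff (g (suc n)) i) +ℤ coeff inner i  ≡⟨ swap (coeff (g 0) i) (coeff (g (suc n)) i) (coeff inner i) ⟩
    (coeff (g 0) i +ℤ coeff inner i) +ℤ coeff (g (suc n)) i  ≡⟨ cong (_+ℤ coeff (g (suc n)) i) (coeff-+P (g 0) inner i) ⟨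
    coeff (g 0 +P inner) i +ℤ coeff (g (suc n)) i            ≡⟨ cong (_+ℤ coeff (g (suc n)) i) (sumP-unfoldˡ (suc (N + N)) g i) ⟨
    coeff (sumP n g) i +ℤ coeff (g (suc n)) i                ≡⟨ coeff-+P (sumP n g) (g (suc n)) i ⟨
    coeff (sumP (suc n) g) i                                 ∎
    where
    swap : ∀ a b c → (a +ℤ b) +ℤ c ≡ (a +ℤ c) +ℤ b
    swap = solve-∀

∣P-f-pairs : ∀ d m N → (∀ c i j → i + j ≡ suc (N + N) → d ∣P (monomial c (i C m) +P monomial c (j C m))) →
             d ∣P f m (suc (N + N))
∣P-f-pairs d m N pairs = ∣P-sumP-pairs d N (λ j → monomial (+ (n C j)) (j C m)) λ i j e →
  subst (λ c → d ∣P (monomial (+ (n C i)) (i C m) +P monomial (+ c) (j C m))) (C-sym i j e) (pairs (+ (n C i)) i j e)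
  where n = suc (N + N)

2+[pred+pred]≡2* : ∀ x → .{{NonZero x}} → suc (suc (pred x + pred x)) ≡ 2 * x
2+[pred+pred]≡2* (suc y) = double y
  where
  double : ∀ y → suc (suc (y + y)) ≡ 2 * suc y
  double = ℕ-Solver.solve-∀

proposition3p1 : (μ k : ℕ) → 1 ≤ μ → 1 ≤ k →
    (∀ p → Prime p → ¬ (2 ∣ p) → p < 2 ^ μ → ¬ (p ∣ k)) →
    zPow+1 k ∣P f (2 ^ μ) ((k + 1) * 2 ^ μ ∸ 1)
proposition3p1 μ@(suc μ′) k@(suc _) 1≤μ _ k-rough =
  subst (λ n → zPow+1 k ∣P f m n) (sym n≡2N+1) (∣P-f-pairs (zPow+1 k) m N pair)
  where
  m = 2 ^ μ
  x = (k + 1) * 2 ^ μ′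
  instance
    _ = m^n≢0 2 μ′
    _ = m*n≢0 (k + 1) (2 ^ μ′)
  N = pred x
  2N+2≡ : suc (suc (N + N)) ≡ m + k * m
  2N+2≡ = trans (2+[pred+pred]≡2* x) (double k (2 ^ μ′))
    where
    double : ∀ k y → 2 * ((k + 1) * y) ≡ 2 * y + k * (2 * y)
    double = ℕ-Solver.solve-∀
  n≡2N+1 : (k + 1) * m ∸ 1 ≡ suc (N + N)
  n≡2N+1 = cong (_∸ 1) (trans (distrib k m) (sym 2N+2≡))
    where
    distrib : ∀ k m → (k + 1) * m ≡ m + k * m
    distrib = ℕ-Solver.solve-∀
  pair : ∀ c i j → i + j ≡ suc (N + N) → zPow+1 k ∣P (monomial c (i C m) +P monomial c (j C m))
  pair c i j e = zPow+1-∣P-monomial-pair k c (i C m) (j C m) (mirror-gap k-rough 1≤μ i j (trans (cong suc e) 2N+2≡))
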